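{- Let $G$ be a convex bipartite graph. If $G$ has a Hamiltonian path, then $G$ satisfies Property B.
   Context: All graphs are finite, simple, connected and unweighted. A convex bipartite graph is a bipartite graph $G$ with bipartition $(X,Y)$ together with an ordering $X=(x_1,\ldots,x_n)$ such that for every $y\in Y$ the neighborhood $N_G(y)$ consists of consecutive vertices of this ordering; $n=|X|$. For $1\le p<q\le n$ let $X_{p..q}=\{x_p,\ldots,x_q\}$, $N_G[X_{p..q}]=\{y\in Y : N_G(y)\subseteq X_{p..q}\}$ and $N'_G[X_{p..q}]=\{y\in Y : |N_G(y)\cap X_{p..q}|\ge 2\}$. A vertex is pendant if it has degree $1$. $G$ satisfies Property B if: (1) (upper bound) for all $1\le p<q\le n$ with $(p,q)\ne(1,n)$, $|N_G[X_{p..q}]|\le q-p+1$, and $|N_G[X_{1..n}]|\le n+1$; (2) (lower bound) for every integer $j\in\{1,\ldots,n-1\}$ and all indices with $1\le p_1<q_1\le p_2<q_2\le\cdots\le p_j<q_j\le n$, $\left|\bigcup_{i=1}^j N'_G[X_{p_i..q_i}]\right|\ge\sum_{i=1}^j (q_i-p_i)$; (3) (pendant bound) $G$ has at most $2$ pendant vertices, and if $n\ge 2$ no $x\in X$ is adjacent to two pendant vertices of $Y$. -}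

module Defs where

open import Data.Nat using (ℕ; zero; suc; _+_; _∸_; _≤_; _<_; _≤ᵇ_; _≡ᵇ_)
open import Data.Fin using (Fin; toℕ)
import Data.Fin as F
open import Data.Bool using (Bool; true; false; _∧_; _∨_; not; if_then_else_)
open import Data.Sum using (_⊎_; inj₁; inj₂)
open import Data.Product using (_×_; Σ; _,_)
open import Data.Unit using (⊤)
open import Data.Empty using (⊥)
open import Data.List using (List; []; _∷_; length)
open import Data.List.Relation.Unary.Linked using (Linked)
open import Data.List.Relation.Unary.Unique.Propositional using (Unique)
open import Data.List.Membership.Propositional using (_∈_)
open import Relation.Binary.PropositionalEquality using (_≡_; _≢_)

-- The ordering of X is x_1, …, x_n where x_i is the element of Fin n
-- with toℕ x_i = i - 1 (so paper index i = suc (toℕ x)).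

record BipGraph (n m : ℕ) : Set where
  field
    adj : Fin n → Fin m → Bool

open BipGraph public

count : (k : ℕ) → (Fin k → Bool) → ℕ
count zero    f = 0
count (suc k) f = (if f F.zero then 1 else 0) + count k (λ i → f (F.suc i))

allB : (k : ℕ) → (Fin k → Bool) → Bool
allB zero    f = true
allB (suc k) f = f F.zero ∧ allB k (λ i → f (F.suc i))

Vertex : ℕ → ℕ → Set
Vertex n m = Fin n ⊎ Fin m

Adj : ∀ {n m} → BipGraph n m → Vertex n m → Vertex n m → Set
Adj G (inj₁ x) (inj₁ x') = ⊥
Adj G (inj₁ x) (inj₂ y)  = adj G x y ≡ true
Adj G (inj₂ y) (inj₁ x)  = adj G x y ≡ true
Adj G (inj₂ y) (inj₂ y') = ⊥

data Walk {n m} (G : BipGraph n m) : Vertex n m → Vertex n m → Set where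
  stay : ∀ {u} → Walk G u u
  step : ∀ {u w v} → Adj G u w → Walk G w v → Walk G u v

Connected : ∀ {n m} → BipGraph n m → Set
Connected G = ∀ u v → Walk G u v

record HamiltonianPath {n m} (G : BipGraph n m) : Set where
  field
    path     : List (Vertex n m)
    linked   : Linked (Adj G) path
    unique   : Unique path
    covering : ∀ v → v ∈ path

Convex : ∀ {n m} → BipGraph n m → Set
Convex {n} {m} G =
  ∀ (y : Fin m) (i j k : Fin n) → toℕ i ≤ toℕ j → toℕ j ≤ toℕ k →
    adj G i y ≡ true → adj G k y ≡ true → adj G j y ≡ true

-- Neighbourhood notions (paper indices p, q are 1-based)

inRange : ∀ {n} → ℕ → ℕ → Fin n → Bool
inRange p q x = (p ≤ᵇ suc (toℕ x)) ∧ (suc (toℕ x) ≤ᵇ q)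

-- y ∈ N_G[X_{p..q}] : N_G(y) ⊆ X_{p..q}
inN : ∀ {n m} → BipGraph n m → ℕ → ℕ → Fin m → Bool
inN {n} G p q y = allB n (λ x → not (adj G x y) ∨ inRange p q x)

-- y ∈ N'_G[X_{p..q}] : |N_G(y) ∩ X_{p..q}| ≥ 2
inN' : ∀ {n m} → BipGraph n m → ℕ → ℕ → Fin m → Bool
inN' {n} G p q y = 2 ≤ᵇ count n (λ x → adj G x y ∧ inRange p q x)

degX : ∀ {n m} → BipGraph n m → Fin n → ℕ
degX {n} {m} G x = count m (λ y → adj G x y)

degY : ∀ {n m} → BipGraph n m → Fin m → ℕ
degY {n} {m} G y = count n (λ x → adj G x y)

IntervalChain : ℕ → ℕ → List (ℕ × ℕ) → Set
IntervalChain n lo []             = ⊤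
IntervalChain n lo ((p , q) ∷ r) = lo ≤ p × p < q × q ≤ n × IntervalChain n q r

inUnionN' : ∀ {n m} → BipGraph n m → List (ℕ × ℕ) → Fin m → Bool
inUnionN' G []             y = false
inUnionN' G ((p , q) ∷ r) y = inN' G p q y ∨ inUnionN' G r y

sumLengths : List (ℕ × ℕ) → ℕ
sumLengths []             = 0
sumLengths ((p , q) ∷ r) = (q ∸ p) + sumLengths r

UpperBound : ∀ {n m} → BipGraph n m → Set
UpperBound {n} {m} G =
  (∀ p q → 1 ≤ p → p < q → q ≤ n → ((p ≡ 1 × q ≡ n) → ⊥) →
     count m (inN G p q) ≤ suc (q ∸ p))
  × count m (inN G 1 n) ≤ n + 1

LowerBound : ∀ {n m} → BipGraph n m → Set
LowerBound {n} {m} G =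
  ∀ (ivs : List (ℕ × ℕ)) → 1 ≤ length ivs → length ivs ≤ n ∸ 1 →
    IntervalChain n 1 ivs →
    sumLengths ivs ≤ count m (inUnionN' G ivs)

PendantBound : ∀ {n m} → BipGraph n m → Set
PendantBound {n} {m} G =
  (count n (λ x → degX G x ≡ᵇ 1) + count m (λ y → degY G y ≡ᵇ 1) ≤ 2)
  × (2 ≤ n → ∀ (x : Fin n) (y₁ y₂ : Fin m) → y₁ ≢ y₂ →
       adj G x y₁ ≡ true → adj G x y₂ ≡ true →
       degY G y₁ ≡ 1 → degY G y₂ ≡ 1 → ⊥)

PropertyB : ∀ {n m} → BipGraph n m → Set
PropertyB G = UpperBound G × LowerBound G × PendantBound G

module Submission where

-- All three parts of Property B are proved by counting along the
-- Hamiltonian path v₁ v₂ … , which alternates between X and Y and lists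
-- every vertex exactly once, so that counting a predicate along the path
-- equals counting it globally.
--  * Upper bound.  If N ⊆ Y and R ⊆ X with N(N) ⊆ R, every N-vertex of the
--    path is preceded by an R-vertex, except possibly the first vertex;
--    hence |N| ≤ |R| + 1, and |N| ≤ |R| as soon as some X-vertex lies outside
--    R.  Take R = X_{p..q}, N = N_G[X_{p..q}].
--  * Lower bound.  Contract every interval [p_i , q_i] of the chain to a point:
--    x_j gets the label #{ t < j | t ∈ ⋃ [p_i , q_i) }, and the labels of X
--    are all of 0 … S with S ≥ Σ (q_i - p_i).  Walking along the path a new
--    label can only appear after a vertex y whose two path neighbours carry
--    different labels, and by convexity such y lies in some N'_G[X_{p_i..q_i}].
--  * Pendant bound.  Inner vertices of the path have degree ≥ 2, so only its
--    two ends can be pendant; two pendant neighbours of one x are excluded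
--    by the first counting lemma with R = {x}.
-- The file develops counting over Fin k and along lists, counting over
-- ranges 1 … N of ℕ, the path lemmas for a fixed graph, the three parts
-- of Property B, and finally the theorem.

open import Defs
open import Data.Nat using (ℕ; zero; suc; _+_; _∸_; _≤_; _<_; _≤ᵇ_; _≡ᵇ_; z≤n; s≤s; _≟_; _≤?_)
open import Data.Nat.Properties
open import Data.Fin using (Fin; toℕ; fromℕ<; fromℕ; inject₁)
import Data.Fin as F
import Data.Fin.Properties as FP
open import Data.Bool using (Bool; true; false; _∧_; _∨_; not; if_then_else_; T)
open import Data.Bool.Properties using (∧-zeroʳ; ∨-zeroʳ; ∨-assoc; ∨-idem; ¬-not)
open import Data.Sum using (_⊎_; inj₁; inj₂)
open import Data.Product using (_×_; ∃; _,_; proj₁; proj₂)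
open import Data.Empty using (⊥; ⊥-elim)
open import Data.List using (List; []; _∷_)
open import Data.List.Relation.Unary.Linked using (Linked; []; [-]; _∷_; tail)
open import Data.List.Relation.Unary.All using (All; []; _∷_)
open import Data.List.Relation.Unary.Any using (here; there)
open import Data.List.Relation.Unary.AllPairs using ([]; _∷_)
open import Data.List.Relation.Unary.Unique.Propositional using (Unique)
open import Data.List.Membership.Propositional using (_∈_)
open import Relation.Binary.PropositionalEquality
open import Relation.Nullary using (¬_; does; yes; no)
open import Relation.Nullary.Decidable using (dec-false)

ind : Bool → ℕ
ind b = if b then 1 else 0

ind≤1 : ∀ b → ind b ≤ 1
ind≤1 true  = ≤-refl
ind≤1 false = z≤n

ind-mono : ∀ {a b} → (a ≡ true → b ≡ true) → ind a ≤ ind b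
ind-mono {false} _ = z≤n
ind-mono {true}  h rewrite h refl = ≤-refl

true≢false : true ≢ false
true≢false ()

T⇒true : ∀ {b} → T b → b ≡ true
T⇒true {true} _ = refl

true⇒T : ∀ {b} → b ≡ true → T b
true⇒T refl = _

∧-true : ∀ {a b} → a ≡ true → b ≡ true → a ∧ b ≡ true
∧-true refl refl = refl

∧-trueˡ : ∀ {a b} → a ∧ b ≡ true → a ≡ true
∧-trueˡ {true}  _ = refl
∧-trueˡ {false} ()

∧-trueʳ : ∀ {a b} → a ∧ b ≡ true → b ≡ true
∧-trueʳ {true}  e = e
∧-trueʳ {false} ()

∨-trueˡ : ∀ {a} b → a ≡ true → a ∨ b ≡ true
∨-trueˡ b refl = refl

∨-trueʳ : ∀ a {b} → b ≡ true → a ∨ b ≡ true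
∨-trueʳ a refl = ∨-zeroʳ a

≤ᵇ-true : ∀ {m n} → m ≤ n → (m ≤ᵇ n) ≡ true
≤ᵇ-true m≤n = T⇒true (≤⇒≤ᵇ m≤n)

≤ᵇ-sound : ∀ {m n} → (m ≤ᵇ n) ≡ true → m ≤ n
≤ᵇ-sound {m} {n} e = ≤ᵇ⇒≤ m n (true⇒T e)

≤ᵇ-false : ∀ {m n} → n < m → (m ≤ᵇ n) ≡ false
≤ᵇ-false n<m = ¬-not (λ e → <⇒≱ n<m (≤ᵇ-sound e))

≡ᵇ-sound : ∀ {m n} → (m ≡ᵇ n) ≡ true → m ≡ n
≡ᵇ-sound {m} {n} e = ≡ᵇ⇒≡ m n (true⇒T e)

≥2⇒≢ᵇ1 : ∀ {c} → 2 ≤ c → (c ≡ᵇ 1) ≡ false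
≥2⇒≢ᵇ1 2≤c = ¬-not (λ e → <⇒≢ 2≤c (sym (≡ᵇ-sound e)))

count-ext : ∀ k {f g : Fin k → Bool} → (∀ i → f i ≡ g i) → count k f ≡ count k g
count-ext zero    e = refl
count-ext (suc k) e = cong₂ _+_ (cong ind (e F.zero)) (count-ext k (λ i → e (F.suc i)))

count-mono : ∀ k {f g : Fin k → Bool} → (∀ i → f i ≡ true → g i ≡ true) → count k f ≤ count k g
count-mono zero    h = z≤n
count-mono (suc k) h = +-mono-≤ (ind-mono (h F.zero)) (count-mono k (λ i → h (F.suc i)))

count-none : ∀ k (g : Fin k → Bool) → (∀ i → g i ≡ false) → count k g ≡ 0
count-none zero    g h = refl
count-none (suc k) g h rewrite h F.zero = count-none k _ (λ i → h (F.suc i))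

count-all : ∀ k (g : Fin k → Bool) → (∀ i → g i ≡ true) → count k g ≡ k
count-all zero    g h = refl
count-all (suc k) g h rewrite h F.zero = cong suc (count-all k _ (λ i → h (F.suc i)))

count≤size : ∀ k (g : Fin k → Bool) → count k g ≤ k
count≤size zero    g = z≤n
count≤size (suc k) g = +-mono-≤ (ind≤1 (g F.zero)) (count≤size k _)

count≥1 : ∀ k (g : Fin k → Bool) i → g i ≡ true → 1 ≤ count k g
count≥1 (suc k) g F.zero    e rewrite e = s≤s z≤n
count≥1 (suc k) g (F.suc i) e = ≤-trans (count≥1 k _ i e) (m≤n+m _ (ind (g F.zero)))

count≥2 : ∀ k (g : Fin k → Bool) i j → i ≢ j → g i ≡ true → g j ≡ true → 2 ≤ count k g
count≥2 (suc k) g F.zero    F.zero    i≢j _  _  = ⊥-elim (i≢j refl)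
count≥2 (suc k) g F.zero    (F.suc j) _   gi gj rewrite gi = s≤s (count≥1 k _ j gj)
count≥2 (suc k) g (F.suc i) F.zero    _   gi gj rewrite gj = s≤s (count≥1 k _ i gi)
count≥2 (suc k) g (F.suc i) (F.suc j) i≢j gi gj =
  ≤-trans (count≥2 k _ i j (λ e → i≢j (cong F.suc e)) gi gj) (m≤n+m _ (ind (g F.zero)))

count≤1 : ∀ k (g : Fin k → Bool) → (∀ i j → g i ≡ true → g j ≡ true → i ≡ j) → count k g ≤ 1
count≤1 zero    g unique = z≤n
count≤1 (suc k) g unique with g F.zero in g0
... | true  = s≤s (≤-reflexive (count-none k _ (λ i → ¬-not (λ gi → zero≢suc (unique _ _ g0 gi)))))
  where
    zero≢suc : ∀ {i : Fin k} → F.zero ≢ F.suc i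
    zero≢suc ()
... | false = count≤1 k _ (λ i j gi gj → FP.suc-injective (unique _ _ gi gj))

count-∨ : ∀ k (f g : Fin k → Bool) → count k (λ i → f i ∨ g i) ≤ count k f + count k g
count-∨ zero    f g = z≤n
count-∨ (suc k) f g with f F.zero | g F.zero
... | true  | true  = s≤s (≤-trans (count-∨ k _ _) (+-monoʳ-≤ (count k (λ i → f (F.suc i))) (n≤1+n _)))
... | true  | false = s≤s (count-∨ k _ _)
... | false | true  = ≤-trans (s≤s (count-∨ k _ _)) (≤-reflexive (sym (+-suc (count k (λ i → f (F.suc i))) _)))
... | false | false = count-∨ k _ _

count-∨-disjoint : ∀ k (f g : Fin k → Bool) → (∀ i → f i ≡ true → g i ≡ false) →
  count k f + count k g ≤ count k (λ i → f i ∨ g i)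
count-∨-disjoint zero    f g disj = z≤n
count-∨-disjoint (suc k) f g disj with f F.zero in f0 | g F.zero in g0
... | true  | true  = ⊥-elim (true≢false (trans (sym g0) (disj F.zero f0)))
... | true  | false = s≤s (count-∨-disjoint k _ _ (λ i → disj (F.suc i)))
... | false | true  = ≤-trans (≤-reflexive (+-suc (count k (λ i → f (F.suc i))) _))
                              (s≤s (count-∨-disjoint k _ _ (λ i → disj (F.suc i))))
... | false | false = count-∨-disjoint k _ _ (λ i → disj (F.suc i))

count-last : ∀ k (f : Fin (suc k) → Bool) → count (suc k) f ≡ count k (λ i → f (inject₁ i)) + ind (f (fromℕ k))
count-last zero    f = +-identityʳ _
count-last (suc k) f =
  trans (cong (ind (f F.zero) +_) (count-last k (λ i → f (F.suc i)))) (sym (+-assoc (ind (f F.zero)) _ _))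

without : ∀ {k} → Fin k → (Fin k → Bool) → Fin k → Bool
without x g i = if does (i FP.≟ x) then false else g i

without-true : ∀ {k} x (g : Fin k → Bool) i → without x g i ≡ true → g i ≡ true × i ≢ x
without-true x g i e with i FP.≟ x
... | no i≢x = e , i≢x

count-without : ∀ k (g : Fin k → Bool) x → count k g ≡ ind (g x) + count k (without x g)
count-without (suc k) g F.zero    = refl
count-without (suc k) g (F.suc x) = begin
  ind g₀ + count k (λ i → g (F.suc i))   ≡⟨ cong (ind g₀ +_) (count-without k (λ i → g (F.suc i)) x) ⟩
  ind g₀ + (ind (g (F.suc x)) + rest)   ≡⟨ sym (+-assoc (ind g₀) _ rest) ⟩
  ind g₀ + ind (g (F.suc x)) + rest     ≡⟨ cong (_+ rest) (+-comm (ind g₀) _) ⟩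
  ind (g (F.suc x)) + ind g₀ + rest     ≡⟨ +-assoc (ind (g (F.suc x))) _ rest ⟩
  ind (g (F.suc x)) + (ind g₀ + rest)   ∎
  where
    open ≡-Reasoning
    g₀ : Bool
    g₀ = g F.zero
    rest : ℕ
    rest = count k (without x (λ i → g (F.suc i)))

countList : ∀ {A : Set} → (A → Bool) → List A → ℕ
countList g []      = 0
countList g (a ∷ l) = ind (g a) + countList g l

countList-mono : ∀ {A : Set} {f g : A → Bool} l → (∀ a → f a ≡ true → g a ≡ true) → countList f l ≤ countList g l
countList-mono []      h = z≤n
countList-mono (a ∷ l) h = +-mono-≤ (ind-mono (h a)) (countList-mono l h)

countList-without : ∀ {k} (g : Fin k → Bool) x l → All (x ≢_) l → countList g l ≡ countList (without x g) l
countList-without g x []      []           = refl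
countList-without g x (y ∷ l) (x≢y ∷ x∉l) with y FP.≟ x
... | yes y≡x = ⊥-elim (x≢y (sym y≡x))
... | no  _   = cong (ind (g y) +_) (countList-without g x l x∉l)

countList≤count : ∀ {k} (g : Fin k → Bool) l → Unique l → countList g l ≤ count k g
countList≤count g []      []          = z≤n
countList≤count {k} g (x ∷ l) (x∉l ∷ uniq) = begin
  ind (g x) + countList g l              ≡⟨ cong (ind (g x) +_) (countList-without g x l x∉l) ⟩
  ind (g x) + countList (without x g) l  ≤⟨ +-monoʳ-≤ (ind (g x)) (countList≤count (without x g) l uniq) ⟩
  ind (g x) + count k (without x g)      ≡⟨ count-without k g x ⟨
  count k g                              ∎
  where open ≤-Reasoning

count≤countList : ∀ {k} (g : Fin k → Bool) l → (∀ i → g i ≡ true → i ∈ l) → count k g ≤ countList g l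
count≤countList {k} g [] covers = ≤-reflexive (count-none k g (λ i → ¬-not (λ gi → not-in-[] (covers i gi))))
  where
    not-in-[] : ∀ {i : Fin k} → ¬ (i ∈ [])
    not-in-[] ()
count≤countList {k} g (x ∷ l) covers = begin
  count k g                              ≡⟨ count-without k g x ⟩
  ind (g x) + count k (without x g)      ≤⟨ +-monoʳ-≤ (ind (g x)) (count≤countList (without x g) l covers-rest) ⟩
  ind (g x) + countList (without x g) l  ≤⟨ +-monoʳ-≤ (ind (g x)) (countList-mono l (λ i e → proj₁ (without-true x g i e))) ⟩
  ind (g x) + countList g l              ∎
  where
    open ≤-Reasoning
    covers-rest : ∀ i → without x g i ≡ true → i ∈ l
    covers-rest i e with covers i (proj₁ (without-true x g i e))
    ... | here i≡x  = ⊥-elim (proj₂ (without-true x g i e) i≡x)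
    ... | there i∈l = i∈l

-- Counting over the range 1 … N of ℕ:  countUpTo N h = #{ t ∈ 1 … N | h t }.
-- Paper indices are 1-based, so x ∈ Fin n has index suc (toℕ x).
countUpTo : ℕ → (ℕ → Bool) → ℕ
countUpTo N h = count N (λ i → h (suc (toℕ i)))

countUpTo-suc : ∀ N h → countUpTo (suc N) h ≡ countUpTo N h + ind (h (suc N))
countUpTo-suc N h = trans (count-last N (λ i → h (suc (toℕ i))))
  (cong₂ _+_ (count-ext N (λ i → cong (λ t → h (suc t)) (FP.toℕ-inject₁ i)))
             (cong (λ t → ind (h (suc t))) (FP.toℕ-fromℕ N)))

countUpTo-step : ∀ N h → countUpTo N h ≤ countUpTo (suc N) h
countUpTo-step N h = ≤-trans (m≤m+n _ _) (≤-reflexive (sym (countUpTo-suc N h)))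

countUpTo-step≤1 : ∀ N h → countUpTo (suc N) h ≤ suc (countUpTo N h)
countUpTo-step≤1 N h = begin
  countUpTo (suc N) h                  ≡⟨ countUpTo-suc N h ⟩
  countUpTo N h + ind (h (suc N))      ≤⟨ +-monoʳ-≤ (countUpTo N h) (ind≤1 (h (suc N))) ⟩
  countUpTo N h + 1                    ≡⟨ +-comm _ 1 ⟩
  suc (countUpTo N h)                  ∎
  where open ≤-Reasoning

countUpTo-mono : ∀ h {M N} → M ≤ N → countUpTo M h ≤ countUpTo N h
countUpTo-mono h {M} {zero}  z≤n = ≤-refl
countUpTo-mono h {M} {suc N} M≤N with M ≟ suc N
... | yes refl = ≤-refl
... | no  M≢N  = ≤-trans (countUpTo-mono h (≤-pred (≤∧≢⇒< M≤N M≢N))) (countUpTo-step N h)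

-- Since countUpTo grows in steps of at most one, it takes every value in
-- between (discrete intermediate value theorem).
countUpTo-intermediate : ∀ N h s → s ≤ countUpTo N h → ∃ λ a → a ≤ N × countUpTo a h ≡ s
countUpTo-intermediate zero    h s s≤0 = 0 , z≤n , sym (n≤0⇒n≡0 s≤0)
countUpTo-intermediate (suc N) h s s≤c with s ≤? countUpTo N h
... | yes s≤c' = let (a , a≤N , e) = countUpTo-intermediate N h s s≤c' in a , m≤n⇒m≤1+n a≤N , e
... | no  s≰c' = suc N , ≤-refl , ≤-antisym (≤-trans (countUpTo-step≤1 N h) (≰⇒> s≰c')) s≤c

countUpTo-jump : ∀ a b h → a ≤ b → countUpTo a h ≢ countUpTo b h → ∃ λ t → a < t × t ≤ b × h t ≡ true
countUpTo-jump a zero    h z≤n changes = ⊥-elim (changes refl)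
countUpTo-jump a (suc b) h a≤b changes with a ≟ suc b
... | yes refl = ⊥-elim (changes refl)
... | no  a≢b with h (suc b) in hb
...   | true  = suc b , s≤s (≤-pred (≤∧≢⇒< a≤b a≢b)) , ≤-refl , hb
...   | false =
  let (t , a<t , t≤b , ht) = countUpTo-jump a b h (≤-pred (≤∧≢⇒< a≤b a≢b)) changes′
  in t , a<t , m≤n⇒m≤1+n t≤b , ht
  where
    unchanged : countUpTo (suc b) h ≡ countUpTo b h
    unchanged = trans (countUpTo-suc b h) (trans (cong (λ c → countUpTo b h + ind c) hb) (+-identityʳ _))
    changes′ : countUpTo a h ≢ countUpTo b h
    changes′ e = changes (trans e (sym unchanged))

countUpTo-from : ∀ p N h → (∀ t → h t ≡ true → p ≤ t) → countUpTo N h ≤ suc N ∸ p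
countUpTo-from p zero    h above = z≤n
countUpTo-from p (suc N) h above rewrite countUpTo-suc N h with h (suc N) in hN
... | true  = begin
  countUpTo N h + 1    ≡⟨ +-comm _ 1 ⟩
  suc (countUpTo N h)  ≤⟨ s≤s (countUpTo-from p N h above) ⟩
  suc (suc N ∸ p)      ≡⟨ +-∸-assoc 1 (above (suc N) hN) ⟨
  suc (suc N) ∸ p      ∎
  where open ≤-Reasoning
... | false = begin
  countUpTo N h + 0    ≡⟨ +-identityʳ _ ⟩
  countUpTo N h        ≤⟨ countUpTo-from p N h above ⟩
  suc N ∸ p            ≤⟨ ∸-monoˡ-≤ p (n≤1+n _) ⟩
  suc (suc N) ∸ p      ∎
  where open ≤-Reasoning

countUpTo-beyond : ∀ q d h → (∀ t → h t ≡ true → t ≤ q) → countUpTo (q + d) h ≡ countUpTo q h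
countUpTo-beyond q zero    h below = cong (λ N → countUpTo N h) (+-identityʳ q)
countUpTo-beyond q (suc d) h below = begin
  countUpTo (q + suc d) h                      ≡⟨ cong (λ N → countUpTo N h) (+-suc q d) ⟩
  countUpTo (suc (q + d)) h                    ≡⟨ countUpTo-suc (q + d) h ⟩
  countUpTo (q + d) h + ind (h (suc (q + d)))  ≡⟨ cong (λ b → countUpTo (q + d) h + ind b) outside ⟩
  countUpTo (q + d) h + 0                      ≡⟨ +-identityʳ _ ⟩
  countUpTo (q + d) h                          ≡⟨ countUpTo-beyond q d h below ⟩
  countUpTo q h                                ∎
  where
    open ≡-Reasoning
    outside : h (suc (q + d)) ≡ false
    outside = ¬-not (λ e → <⇒≱ (s≤s (m≤m+n q d)) (below _ e))

countUpTo-within : ∀ p q N h → (∀ t → h t ≡ true → p ≤ t × t ≤ q) → p ≤ q → q ≤ N →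
  countUpTo N h ≤ suc (q ∸ p)
countUpTo-within p q N h support p≤q q≤N = begin
  countUpTo N h              ≡⟨ cong (λ M → countUpTo M h) (m+[n∸m]≡n q≤N) ⟨
  countUpTo (q + (N ∸ q)) h  ≡⟨ countUpTo-beyond q (N ∸ q) h (λ t e → proj₂ (support t e)) ⟩
  countUpTo q h              ≤⟨ countUpTo-from p q h (λ t e → proj₁ (support t e)) ⟩
  suc q ∸ p                  ≡⟨ +-∸-assoc 1 p≤q ⟩
  suc (q ∸ p)                ∎
  where open ≤-Reasoning

countUpTo-cover : ∀ {p} d N h → 1 ≤ p → p + d ≤ suc N → (∀ t → p ≤ t → t < p + d → h t ≡ true) →
  d ≤ countUpTo N h
countUpTo-cover zero N h _ _ _ = z≤n
countUpTo-cover {suc p} (suc d) N h 1≤p bound covered = begin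
  suc d                                        ≡⟨ +-comm 1 d ⟩
  d + ind true                                 ≤⟨ +-monoˡ-≤ 1 (countUpTo-cover d (p + d) h 1≤p ≤-refl covered′) ⟩
  countUpTo (p + d) h + ind true               ≡⟨ cong (λ b → countUpTo (p + d) h + ind b) last-covered ⟨
  countUpTo (p + d) h + ind (h (suc (p + d)))  ≡⟨ countUpTo-suc (p + d) h ⟨
  countUpTo (suc (p + d)) h                    ≤⟨ countUpTo-mono h (≤-trans (≤-reflexive (sym (+-suc p d))) (≤-pred bound)) ⟩
  countUpTo N h                                ∎
  where
    open ≤-Reasoning
    covered′ : ∀ t → suc p ≤ t → t < suc p + d → h t ≡ true
    covered′ t p≤t t<p+d = covered t p≤t (≤-trans t<p+d (s≤s (+-monoʳ-≤ p (n≤1+n d))))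
    last-covered : h (suc (p + d)) ≡ true
    last-covered = covered _ (s≤s (m≤m+n p d)) (s≤s (≤-reflexive (sym (+-suc p d))))

-- Intervals of the lower bound: t ∈ [p, q) means that x_t and x_{t+1} both lie in X_{p..q}.
halfOpen : ℕ → ℕ → ℕ → Bool
halfOpen p q t = (p ≤ᵇ t) ∧ (suc t ≤ᵇ q)

inSomeInterval : List (ℕ × ℕ) → ℕ → Bool
inSomeInterval []            t = false
inSomeInterval ((p , q) ∷ r) t = halfOpen p q t ∨ inSomeInterval r t

inSomeInterval-above : ∀ n lo ivs t → IntervalChain n lo ivs → inSomeInterval ivs t ≡ true → lo ≤ t
inSomeInterval-above n lo ((p , q) ∷ r) t (lo≤p , p<q , _ , chain) e with halfOpen p q t in in-first
... | true  = ≤-trans lo≤p (≤ᵇ-sound (∧-trueˡ in-first))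
... | false = ≤-trans lo≤p (≤-trans (<⇒≤ p<q) (inSomeInterval-above n q r t chain e))

-- The intervals of a chain are disjoint, so together they cover Σ (q_i - p_i) numbers.
chain-count : ∀ n N lo ivs → 1 ≤ lo → n ≤ suc N → IntervalChain n lo ivs →
  sumLengths ivs ≤ countUpTo N (inSomeInterval ivs)
chain-count n N lo []            _    _   _ = z≤n
chain-count n N lo ((p , q) ∷ r) 1≤lo n≤N (lo≤p , p<q , q≤n , chain) = begin
  (q ∸ p) + sumLengths r
    ≤⟨ +-mono-≤ first (chain-count n N q r (≤-trans 1≤p (<⇒≤ p<q)) n≤N chain) ⟩
  countUpTo N (halfOpen p q) + countUpTo N (inSomeInterval r)
    ≤⟨ count-∨-disjoint N _ _ disjoint ⟩
  countUpTo N (inSomeInterval ((p , q) ∷ r))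
    ∎
  where
    open ≤-Reasoning
    1≤p : 1 ≤ p
    1≤p = ≤-trans 1≤lo lo≤p
    p+len≡q : p + (q ∸ p) ≡ q
    p+len≡q = m+[n∸m]≡n (<⇒≤ p<q)
    first : q ∸ p ≤ countUpTo N (halfOpen p q)
    first = countUpTo-cover (q ∸ p) N _ 1≤p (≤-trans (≤-reflexive p+len≡q) (≤-trans q≤n n≤N))
      (λ t p≤t t<q → ∧-true (≤ᵇ-true p≤t) (≤ᵇ-true (≤-trans t<q (≤-reflexive p+len≡q))))
    disjoint : ∀ (i : Fin N) → halfOpen p q (suc (toℕ i)) ≡ true → inSomeInterval r (suc (toℕ i)) ≡ false
    disjoint i e = ¬-not (λ e′ → <⇒≱ (≤ᵇ-sound (∧-trueʳ e)) (inSomeInterval-above n q r _ chain e′))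

module Paths {n m : ℕ} (G : BipGraph n m) where

  V : Set
  V = Vertex n m

  xsOf : List V → List (Fin n)
  xsOf []           = []
  xsOf (inj₁ x ∷ L) = x ∷ xsOf L
  xsOf (inj₂ y ∷ L) = xsOf L

  ysOf : List V → List (Fin m)
  ysOf []           = []
  ysOf (inj₁ x ∷ L) = ysOf L
  ysOf (inj₂ y ∷ L) = y ∷ ysOf L

  ∈-xsOf : ∀ {x} L → inj₁ x ∈ L → x ∈ xsOf L
  ∈-xsOf (inj₁ _ ∷ L) (here refl) = here refl
  ∈-xsOf (inj₁ _ ∷ L) (there x∈L) = there (∈-xsOf L x∈L)
  ∈-xsOf (inj₂ _ ∷ L) (there x∈L) = ∈-xsOf L x∈L

  ∈-ysOf : ∀ {y} L → inj₂ y ∈ L → y ∈ ysOf L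
  ∈-ysOf (inj₂ _ ∷ L) (here refl) = here refl
  ∈-ysOf (inj₂ _ ∷ L) (there y∈L) = there (∈-ysOf L y∈L)
  ∈-ysOf (inj₁ _ ∷ L) (there y∈L) = ∈-ysOf L y∈L

  xsOf-unique : ∀ L → Unique L → Unique (xsOf L)
  xsOf-unique []           []           = []
  xsOf-unique (inj₁ x ∷ L) (x∉L ∷ uniq) = fresh L x∉L ∷ xsOf-unique L uniq
    where
      fresh : ∀ L → All (inj₁ x ≢_) L → All (x ≢_) (xsOf L)
      fresh []            []         = []
      fresh (inj₁ x′ ∷ L) (ne ∷ nes) = (λ e → ne (cong inj₁ e)) ∷ fresh L nes
      fresh (inj₂ _  ∷ L) (_  ∷ nes) = fresh L nes
  xsOf-unique (inj₂ y ∷ L) (_ ∷ uniq)   = xsOf-unique L uniq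

  ysOf-unique : ∀ L → Unique L → Unique (ysOf L)
  ysOf-unique []           []           = []
  ysOf-unique (inj₁ x ∷ L) (_ ∷ uniq)   = ysOf-unique L uniq
  ysOf-unique (inj₂ y ∷ L) (y∉L ∷ uniq) = fresh L y∉L ∷ ysOf-unique L uniq
    where
      fresh : ∀ L → All (inj₂ y ≢_) L → All (y ≢_) (ysOf L)
      fresh []            []         = []
      fresh (inj₁ _  ∷ L) (_  ∷ nes) = fresh L nes
      fresh (inj₂ y′ ∷ L) (ne ∷ nes) = (λ e → ne (cong inj₂ e)) ∷ fresh L nes

  -- A Hamiltonian path lists every vertex exactly once, so counting along
  -- it is the same as counting over the whole side.
  countX-along : (hp : HamiltonianPath G) (g : Fin n → Bool) →
    countList g (xsOf (HamiltonianPath.path hp)) ≡ count n g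
  countX-along hp g = ≤-antisym
    (countList≤count g (xsOf path) (xsOf-unique path unique))
    (count≤countList g (xsOf path) (λ x _ → ∈-xsOf path (covering (inj₁ x))))
    where open HamiltonianPath hp

  countY-along : (hp : HamiltonianPath G) (g : Fin m → Bool) →
    countList g (ysOf (HamiltonianPath.path hp)) ≡ count m g
  countY-along hp g = ≤-antisym
    (countList≤count g (ysOf path) (ysOf-unique path unique))
    (count≤countList g (ysOf path) (λ y _ → ∈-ysOf path (covering (inj₂ y))))
    where open HamiltonianPath hp

  -- Closed pairs: R ⊆ X and N ⊆ Y such that every neighbour of an N-vertex
  -- lies in R.  On a path each N-vertex is preceded by an R-vertex, except
  -- possibly the first vertex of the path.
  module ClosedPair (R : Fin n → Bool) (N : Fin m → Bool)
                    (closed : ∀ x y → N y ≡ true → adj G x y ≡ true → R x ≡ true) where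

    #N : List V → ℕ
    #N L = countList N (ysOf L)

    #R : List V → ℕ
    #R L = countList R (xsOf L)

    from-x : ∀ x L → Linked (Adj G) (inj₁ x ∷ L) → #N (inj₁ x ∷ L) ≤ #R (inj₁ x ∷ L)
    after-y : ∀ y L → Linked (Adj G) (inj₂ y ∷ L) → #N L ≤ #R L

    from-x x []           [-]          = z≤n
    from-x x (inj₁ _ ∷ L) (() ∷ _)
    from-x x (inj₂ y ∷ L) (x~y ∷ path) =
      +-mono-≤ (ind-mono (λ Ny → closed x y Ny x~y)) (after-y y L path)

    after-y y []           [-]      = z≤n
    after-y y (inj₂ _ ∷ L) (() ∷ _)
    after-y y (inj₁ x ∷ L) (_ ∷ path) = from-x x L path

    -- In general only a leading N-vertex is unmatched.
    closed-along : ∀ L → Linked (Adj G) L → #N L ≤ suc (#R L)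
    closed-along []           _    = z≤n
    closed-along (inj₁ x ∷ L) path = m≤n⇒m≤1+n (from-x x L path)
    closed-along (inj₂ y ∷ L) path = +-mono-≤ (ind≤1 (N y)) (after-y y L path)

    -- If an X-vertex outside R lies on the path, then #N ≤ #R: a leading
    -- pair y x with y ∈ N has x ∈ R and can be dropped, and once the path
    -- starts with an X-vertex or with a Y-vertex outside N, `from-x` and
    -- `after-y` apply; the vertex outside R is never dropped.
    closed-along-strict : ∀ L → Linked (Adj G) L → ∀ x₀ → inj₁ x₀ ∈ L → R x₀ ≡ false → #N L ≤ #R L
    closed-along-strict (inj₁ x ∷ L)          path         _  _            _   = from-x x L path
    closed-along-strict (inj₂ y ∷ [])         _            _  (there ())   _
    closed-along-strict (inj₂ y ∷ inj₂ _ ∷ L) (() ∷ _)     _  _            _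
    closed-along-strict (inj₂ y ∷ inj₁ x ∷ L) (y~x ∷ path) x₀ (there x₀∈) out with N y in Ny
    ... | false = after-y y (inj₁ x ∷ L) (y~x ∷ path)
    ... | true with x₀∈
    ...   | here refl  = ⊥-elim (true≢false (trans (sym (closed x₀ y Ny y~x)) out))
    ...   | there x₀∈L = +-mono-≤ (ind-mono (λ _ → closed x y Ny y~x))
                                  (closed-along-strict L (tail path) x₀ x₀∈L out)

  pendant : V → Bool
  pendant (inj₁ x) = degX G x ≡ᵇ 1
  pendant (inj₂ y) = degY G y ≡ᵇ 1

  countList-pendant : ∀ L →
    countList pendant L ≡ countList (λ x → pendant (inj₁ x)) (xsOf L) + countList (λ y → pendant (inj₂ y)) (ysOf L)
  countList-pendant []           = refl
  countList-pendant (inj₁ x ∷ L) =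
    trans (cong (ind (pendant (inj₁ x)) +_) (countList-pendant L)) (sym (+-assoc (ind (pendant (inj₁ x))) _ _))
  countList-pendant (inj₂ y ∷ L) = begin
    a + rest       ≡⟨ cong (a +_) (countList-pendant L) ⟩
    a + (xs + ys)  ≡⟨ sym (+-assoc a xs ys) ⟩
    a + xs + ys    ≡⟨ cong (_+ ys) (+-comm a xs) ⟩
    xs + a + ys    ≡⟨ +-assoc xs a ys ⟩
    xs + (a + ys)  ∎
    where
      open ≡-Reasoning
      a xs ys rest : ℕ
      a    = ind (pendant (inj₂ y))
      xs   = countList (λ x → pendant (inj₁ x)) (xsOf L)
      ys   = countList (λ y → pendant (inj₂ y)) (ysOf L)
      rest = countList pendant L

  two-neighbours : ∀ u v w → Adj G u v → Adj G v w → u ≢ w → pendant v ≡ false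
  two-neighbours (inj₂ y₁) (inj₁ x) (inj₂ y₂) y₁~x x~y₂ y₁≢y₂ =
    ≥2⇒≢ᵇ1 (count≥2 m (adj G x) y₁ y₂ (λ e → y₁≢y₂ (cong inj₂ e)) y₁~x x~y₂)
  two-neighbours (inj₁ x₁) (inj₂ y) (inj₁ x₂) x₁~y y~x₂ x₁≢x₂ =
    ≥2⇒≢ᵇ1 (count≥2 n (λ x → adj G x y) x₁ x₂ (λ e → x₁≢x₂ (cong inj₁ e)) x₁~y y~x₂)
  two-neighbours (inj₁ _) (inj₁ _) _        ()
  two-neighbours (inj₂ _) (inj₂ _) _        ()
  two-neighbours (inj₂ _) (inj₁ _) (inj₁ _) _  ()
  two-neighbours (inj₁ _) (inj₂ _) (inj₂ _) _  ()

  -- Every vertex strictly inside a path is not pendant, so after the first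
  -- vertex at most the last one is.
  pendants-after-first : ∀ u L → Linked (Adj G) (u ∷ L) → Unique (u ∷ L) → countList pendant L ≤ 1
  pendants-after-first u []          _              _                        = z≤n
  pendants-after-first u (v ∷ [])    _              _                        = ≤-trans (≤-reflexive (+-identityʳ _)) (ind≤1 _)
  pendants-after-first u (v ∷ w ∷ L) (u~v ∷ v~w ∷ path) ((_ ∷ u≢w ∷ _) ∷ uniq)
    rewrite two-neighbours u v w u~v v~w u≢w = pendants-after-first v (w ∷ L) (v~w ∷ path) uniq

  pendants-along : ∀ L → Linked (Adj G) L → Unique L → countList pendant L ≤ 2
  pendants-along []      _    _    = z≤n
  pendants-along (u ∷ L) path uniq = +-mono-≤ (ind≤1 (pendant u)) (pendants-after-first u L path uniq)

  -- Labelled X-vertices: walking along a path, a label not seen before can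
  -- only appear right after a Y-vertex whose two path neighbours carry
  -- different labels.
  module Labels (label : Fin n → ℕ) where

    labelled : List V → ℕ → Bool
    labelled []           s = false
    labelled (inj₁ x ∷ L) s = (label x ≡ᵇ s) ∨ labelled L s
    labelled (inj₂ y ∷ L) s = labelled L s

    labelsBelow : ℕ → List V → ℕ
    labelsBelow k L = count k (λ s → labelled L (toℕ s))

    labelled-∈ : ∀ {x} L → inj₁ x ∈ L → labelled L (label x) ≡ true
    labelled-∈ {x} (inj₁ _ ∷ L) (here refl) = ∨-trueˡ _ (T⇒true (≡⇒≡ᵇ (label x) (label x) refl))
    labelled-∈     (inj₁ x′ ∷ L) (there x∈L) = ∨-trueʳ (label x′ ≡ᵇ _) (labelled-∈ L x∈L)
    labelled-∈     (inj₂ _ ∷ L)  (there x∈L) = labelled-∈ L x∈L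

    labelsBelow-[] : ∀ k → labelsBelow k [] ≡ 0
    labelsBelow-[] k = count-none k _ (λ _ → refl)

    labelsBelow-cons : ∀ k x L → labelsBelow k (inj₁ x ∷ L) ≤ suc (labelsBelow k L)
    labelsBelow-cons k x L =
      ≤-trans (count-∨ k (λ s → label x ≡ᵇ toℕ s) (λ s → labelled L (toℕ s)))
              (+-monoˡ-≤ (labelsBelow k L) (count≤1 k _ one-label))
      where
        one-label : ∀ i j → (label x ≡ᵇ toℕ i) ≡ true → (label x ≡ᵇ toℕ j) ≡ true → i ≡ j
        one-label i j ei ej = FP.toℕ-injective (trans (sym (≡ᵇ-sound {label x} ei)) (≡ᵇ-sound {label x} ej))

    labelsBelow-repeat : ∀ k x y x′ L → label x ≡ label x′ →
      labelsBelow k (inj₁ x ∷ inj₂ y ∷ inj₁ x′ ∷ L) ≤ labelsBelow k (inj₁ x′ ∷ L)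
    labelsBelow-repeat k x y x′ L same rewrite same = count-mono k (λ s e →
      trans (sym (absorb (label x′ ≡ᵇ toℕ s) (labelled L (toℕ s)))) e)
      where
        absorb : ∀ a b → a ∨ (a ∨ b) ≡ a ∨ b
        absorb a b = trans (sym (∨-assoc a a b)) (cong (_∨ b) (∨-idem a))

    labels-along : (separator : Fin m → Bool) →
      (∀ x y x′ → adj G x y ≡ true → adj G x′ y ≡ true → label x ≢ label x′ → separator y ≡ true) →
      ∀ k L → Linked (Adj G) L → labelsBelow k L ≤ suc (countList separator (ysOf L))
    labels-along sep separates k = go
      where
        go : ∀ L → Linked (Adj G) L → labelsBelow k L ≤ suc (countList sep (ysOf L))
        go []                          _    = ≤-trans (≤-reflexive (labelsBelow-[] k)) z≤n
        go (inj₂ y ∷ [])               _    = ≤-trans (go [] []) (s≤s z≤n)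
        go (inj₂ y ∷ L@(_ ∷ _))        (_ ∷ path) = ≤-trans (go L path) (s≤s (m≤n+m _ (ind (sep y))))
        go (inj₁ x ∷ [])               _    = ≤-trans (labelsBelow-cons k x []) (s≤s (≤-reflexive (labelsBelow-[] k)))
        go (inj₁ x ∷ inj₁ _ ∷ L)       (() ∷ _)
        go (inj₁ x ∷ inj₂ y ∷ [])      _    =
          ≤-trans (labelsBelow-cons k x (inj₂ y ∷ [])) (s≤s (≤-trans (≤-reflexive (labelsBelow-[] k)) z≤n))
        go (inj₁ x ∷ inj₂ y ∷ inj₂ _ ∷ L) (_ ∷ () ∷ _)
        go (inj₁ x ∷ inj₂ y ∷ inj₁ x′ ∷ L) (x~y ∷ y~x′ ∷ path) with label x ≟ label x′
        ... | yes same = ≤-trans (labelsBelow-repeat k x y x′ L same)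
                                 (≤-trans (go (inj₁ x′ ∷ L) path) (s≤s (m≤n+m _ (ind (sep y)))))
        ... | no differ rewrite separates x y x′ x~y y~x′ differ =
          ≤-trans (labelsBelow-cons k x (inj₂ y ∷ inj₁ x′ ∷ L)) (s≤s (go (inj₁ x′ ∷ L) path))

allB-true : ∀ k (f : Fin k → Bool) i → allB k f ≡ true → f i ≡ true
allB-true (suc k) f F.zero    e = ∧-trueˡ e
allB-true (suc k) f (F.suc i) e = allB-true k _ i (∧-trueʳ {f F.zero} e)

inN-closed : ∀ {n m} (G : BipGraph n m) p q x y → inN G p q y ≡ true → adj G x y ≡ true → inRange p q x ≡ true
inN-closed {n} G p q x y y∈N x~y =
  subst (λ a → not a ∨ inRange p q x ≡ true) x~y (allB-true n _ x y∈N)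

inRange-count : ∀ n p q → p ≤ q → q ≤ n → count n (inRange p q) ≤ suc (q ∸ p)
inRange-count n p q = countUpTo-within p q n (λ t → (p ≤ᵇ t) ∧ (t ≤ᵇ q))
  (λ t e → ≤ᵇ-sound (∧-trueˡ e) , ≤ᵇ-sound (∧-trueʳ {p ≤ᵇ t} e))

-- Unless [p, q] = [1, n], some x lies outside X_{p..q}: x_1 if p > 1, x_{q+1} if q < n.
outside-interval : ∀ n p q → 1 ≤ p → p < q → q ≤ n → ¬ (p ≡ 1 × q ≡ n) → ∃ λ (x : Fin n) → inRange p q x ≡ false
outside-interval zero    p q _ p<q q≤0 _ = ⊥-elim (<⇒≱ (≤-trans p<q q≤0) z≤n)
outside-interval (suc n) p q 1≤p _ q≤n not-whole with p ≟ 1 | q ≟ suc n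
... | no p≢1 | _ = F.zero , cong (_∧ (1 ≤ᵇ q)) (≤ᵇ-false (≤∧≢⇒< 1≤p (λ e → p≢1 (sym e))))
... | yes p≡1 | yes q≡n = ⊥-elim (not-whole (p≡1 , q≡n))
... | yes _   | no q≢n  = fromℕ< q<n , beyond
  where
    q<n : q < suc n
    q<n = ≤∧≢⇒< q≤n q≢n
    beyond : inRange p q (fromℕ< q<n) ≡ false
    beyond rewrite FP.toℕ-fromℕ< q<n | ≤ᵇ-false {suc q} {q} ≤-refl = ∧-zeroʳ (p ≤ᵇ suc q)

-- R = X_{p..q} and N = N_G[X_{p..q}] form a closed pair; for a proper
-- interval some x lies outside X_{p..q}, giving the sharper bound.
upperBound : ∀ {n m} (G : BipGraph n m) → HamiltonianPath G → UpperBound G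
upperBound {n} {m} G hp = proper , whole
  where
    open HamiltonianPath hp
    open Paths G

    proper : ∀ p q → 1 ≤ p → p < q → q ≤ n → ¬ (p ≡ 1 × q ≡ n) → count m (inN G p q) ≤ suc (q ∸ p)
    proper p q 1≤p p<q q≤n not-whole = begin
      count m (inN G p q)                  ≡⟨ countY-along hp _ ⟨
      countList (inN G p q) (ysOf path)    ≤⟨ closed-along-strict path linked x₀ (covering (inj₁ x₀)) x₀-outside ⟩
      countList (inRange p q) (xsOf path)  ≡⟨ countX-along hp _ ⟩
      count n (inRange p q)                ≤⟨ inRange-count n p q (<⇒≤ p<q) q≤n ⟩
      suc (q ∸ p)                          ∎
      where
        open ≤-Reasoning
        open ClosedPair (inRange p q) (inN G p q) (inN-closed G p q)
        outside : ∃ λ (x : Fin n) → inRange p q x ≡ false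
        outside = outside-interval n p q 1≤p p<q q≤n not-whole
        x₀ : Fin n
        x₀ = proj₁ outside
        x₀-outside : inRange p q x₀ ≡ false
        x₀-outside = proj₂ outside

    whole : count m (inN G 1 n) ≤ n + 1
    whole = begin
      count m (inN G 1 n)                       ≡⟨ countY-along hp _ ⟨
      countList (inN G 1 n) (ysOf path)         ≤⟨ closed-along path linked ⟩
      suc (countList (inRange 1 n) (xsOf path)) ≡⟨ cong suc (countX-along hp _) ⟩
      suc (count n (inRange 1 n))               ≤⟨ s≤s (count≤size n _) ⟩
      suc n                                     ≡⟨ +-comm 1 n ⟩
      n + 1                                     ∎
      where
        open ≤-Reasoning
        open ClosedPair (inRange 1 n) (inN G 1 n) (inN-closed G 1 n)

inUnionN'-at : ∀ {n m} (G : BipGraph n m) ivs t y →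
  (∀ p q → halfOpen p q t ≡ true → inN' G p q y ≡ true) →
  inSomeInterval ivs t ≡ true → inUnionN' G ivs y ≡ true
inUnionN'-at G ((p , q) ∷ r) t y at-t e with halfOpen p q t in in-first
... | true  = ∨-trueˡ _ (at-t p q in-first)
... | false = ∨-trueʳ (inN' G p q y) (inUnionN'-at G r t y at-t e)

-- By convexity, a neighbourhood containing x and x′ with toℕ x ≤ t < toℕ x′
-- contains the consecutive pair x_{t+1}, x_{t+2} (paper indices); if
-- t + 1 ∈ [p, q) both lie in X_{p..q}, so y ∈ N'_G[X_{p..q}].
consecutive-pair : ∀ {n m} (G : BipGraph n m) → Convex G → ∀ y (x x′ : Fin n) t p q →
  toℕ x ≤ t → suc t ≤ toℕ x′ → adj G x y ≡ true → adj G x′ y ≡ true →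
  halfOpen p q (suc t) ≡ true → inN' G p q y ≡ true
consecutive-pair {n} G convex y x x′ t p q x≤t t<x′ x~y x′~y inside =
  ≤ᵇ-true (count≥2 n (λ z → adj G z y ∧ inRange p q z) xₜ xₜ₊₁ distinct
    (good xₜ (≤-reflexive (sym toℕ-xₜ)) (≤-trans (≤-reflexive toℕ-xₜ) (n≤1+n t)))
    (good xₜ₊₁ (≤-trans (n≤1+n t) (≤-reflexive (sym toℕ-xₜ₊₁))) (≤-reflexive toℕ-xₜ₊₁)))
  where
    xₜ : Fin n
    xₜ = fromℕ< (≤-trans (n≤1+n _) (≤-trans (s≤s t<x′) (FP.toℕ<n x′)))
    xₜ₊₁ : Fin n
    xₜ₊₁ = fromℕ< (≤-trans (s≤s t<x′) (FP.toℕ<n x′))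
    toℕ-xₜ : toℕ xₜ ≡ t
    toℕ-xₜ = FP.toℕ-fromℕ< _
    toℕ-xₜ₊₁ : toℕ xₜ₊₁ ≡ suc t
    toℕ-xₜ₊₁ = FP.toℕ-fromℕ< _
    distinct : xₜ ≢ xₜ₊₁
    distinct e = 1+n≢n (trans (sym toℕ-xₜ₊₁) (trans (cong toℕ (sym e)) toℕ-xₜ))
    p≤t+1 : p ≤ suc t
    p≤t+1 = ≤ᵇ-sound {p} {suc t} (∧-trueˡ inside)
    t+2≤q : suc (suc t) ≤ q
    t+2≤q = ≤ᵇ-sound {suc (suc t)} {q} (∧-trueʳ {p ≤ᵇ suc t} inside)
    good : ∀ z → t ≤ toℕ z → toℕ z ≤ suc t → adj G z y ∧ inRange p q z ≡ true
    good z t≤z z≤t+1 = ∧-true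
      (convex y x z x′ (≤-trans x≤t t≤z) (≤-trans z≤t+1 t<x′) x~y x′~y)
      (∧-true (≤ᵇ-true {p} {suc (toℕ z)} (≤-trans p≤t+1 (s≤s t≤z)))
              (≤ᵇ-true {suc (toℕ z)} {q} (≤-trans (s≤s z≤t+1) t+2≤q)))

-- x ↦ the number of t < index(x) lying in one of the intervals, i.e. the
-- position of x once every interval [p_j , q_j] is contracted to a point.
intervalLabel : List (ℕ × ℕ) → ∀ {n} → Fin n → ℕ
intervalLabel ivs x = countUpTo (toℕ x) (inSomeInterval ivs)

separator-ordered : ∀ {n m} (G : BipGraph n m) → Convex G → ∀ ivs (x : Fin n) y (x′ : Fin n) →
  toℕ x ≤ toℕ x′ → adj G x y ≡ true → adj G x′ y ≡ true →
  intervalLabel ivs x ≢ intervalLabel ivs x′ → inUnionN' G ivs y ≡ true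
separator-ordered G convex ivs x y x′ x≤x′ x~y x′~y differ
  with countUpTo-jump (toℕ x) (toℕ x′) (inSomeInterval ivs) x≤x′ differ
... | zero  , ()      , _    , _
... | suc t , s≤s x≤t , t<x′ , stepped =
  inUnionN'-at G ivs (suc t) y (λ p q → consecutive-pair G convex y x x′ t p q x≤t t<x′ x~y x′~y) stepped

separator : ∀ {n m} (G : BipGraph n m) → Convex G → ∀ ivs (x : Fin n) y (x′ : Fin n) →
  adj G x y ≡ true → adj G x′ y ≡ true →
  intervalLabel ivs x ≢ intervalLabel ivs x′ → inUnionN' G ivs y ≡ true
separator G convex ivs x y x′ x~y x′~y differ with ≤-total (toℕ x) (toℕ x′)
... | inj₁ x≤x′ = separator-ordered G convex ivs x y x′ x≤x′ x~y x′~y differ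
... | inj₂ x′≤x = separator-ordered G convex ivs x′ y x x′≤x x′~y x~y (λ e → differ (sym e))

-- The labels of X are 0 … S with S ≥ Σ (q_i - p_i); all of them occur on
-- the path, and a new one only after a separator, so S ≤ #separators.
lowerBound : ∀ {n m} (G : BipGraph n m) → Convex G → HamiltonianPath G → LowerBound G
lowerBound {n} {m} G convex hp ivs 1≤len len≤n-1 chain = ≤-pred (begin
  suc (sumLengths ivs)                          ≤⟨ s≤s (chain-count n (n ∸ 1) 1 ivs ≤-refl (≤-reflexive (sym 1+[n-1]≡n)) chain) ⟩
  suc S                                         ≡⟨ count-all (suc S) _ every-label-occurs ⟨
  labelsBelow (suc S) path                      ≤⟨ labels-along (inUnionN' G ivs) (separator G convex ivs) (suc S) path linked ⟩
  suc (countList (inUnionN' G ivs) (ysOf path)) ≡⟨ cong suc (countY-along hp _) ⟩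
  suc (count m (inUnionN' G ivs))               ∎)
  where
    open ≤-Reasoning
    open HamiltonianPath hp
    open Paths G
    open Labels (intervalLabel ivs)

    S : ℕ
    S = countUpTo (n ∸ 1) (inSomeInterval ivs)

    1+[n-1]≡n : suc (n ∸ 1) ≡ n
    1+[n-1]≡n = m+[n∸m]≡n (≤-trans (≤-trans 1≤len len≤n-1) (m∸n≤m n 1))

    every-label-occurs : ∀ (s : Fin (suc S)) → labelled path (toℕ s) ≡ true
    every-label-occurs s with countUpTo-intermediate (n ∸ 1) (inSomeInterval ivs) (toℕ s) (≤-pred (FP.toℕ<n s))
    ... | a , a≤n-1 , label≡s =
      subst (λ l → labelled path l ≡ true) label-xₐ (labelled-∈ path (covering (inj₁ xₐ)))
      where
        a<n : a < n
        a<n = ≤-trans (s≤s a≤n-1) (≤-reflexive 1+[n-1]≡n)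
        xₐ : Fin n
        xₐ = fromℕ< a<n
        label-xₐ : intervalLabel ivs xₐ ≡ toℕ s
        label-xₐ = trans (cong (λ i → countUpTo i (inSomeInterval ivs)) (FP.toℕ-fromℕ< a<n)) label≡s

another : ∀ {k} → 2 ≤ k → (x : Fin k) → ∃ λ x′ → x′ ≢ x
another {suc (suc k)} _ F.zero    = F.suc F.zero , λ ()
another {suc (suc k)} _ (F.suc _) = F.zero , λ ()
another {suc zero}    (s≤s ()) _

pendantBound : ∀ {n m} (G : BipGraph n m) → HamiltonianPath G → PendantBound G
pendantBound {n} {m} G hp = at-most-two , no-shared-pendants
  where
    open HamiltonianPath hp
    open Paths G

    at-most-two : count n (λ x → degX G x ≡ᵇ 1) + count m (λ y → degY G y ≡ᵇ 1) ≤ 2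
    at-most-two = begin
      count n (λ x → degX G x ≡ᵇ 1) + count m (λ y → degY G y ≡ᵇ 1)
        ≡⟨ cong₂ _+_ (countX-along hp _) (countY-along hp _) ⟨
      countList (λ x → degX G x ≡ᵇ 1) (xsOf path) + countList (λ y → degY G y ≡ᵇ 1) (ysOf path)
        ≡⟨ countList-pendant path ⟨
      countList pendant path
        ≤⟨ pendants-along path linked unique ⟩
      2 ∎
      where open ≤-Reasoning

    -- The pendant neighbours of x form a closed pair with R = {x}; as some
    -- other X-vertex exists, there is at most one of them.
    no-shared-pendants : 2 ≤ n → ∀ (x : Fin n) (y₁ y₂ : Fin m) → y₁ ≢ y₂ →
      adj G x y₁ ≡ true → adj G x y₂ ≡ true → degY G y₁ ≡ 1 → degY G y₂ ≡ 1 → ⊥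
    no-shared-pendants 2≤n x y₁ y₂ y₁≢y₂ x~y₁ x~y₂ deg₁ deg₂ = <-irrefl refl (begin
      2                                ≤⟨ count≥2 m N y₁ y₂ y₁≢y₂ (∧-true (pendant-y deg₁) x~y₁) (∧-true (pendant-y deg₂) x~y₂) ⟩
      count m N                        ≡⟨ countY-along hp N ⟨
      countList N (ysOf path)          ≤⟨ closed-along-strict path linked x′ (covering (inj₁ x′)) (dec-false (x′ FP.≟ x) x′≢x) ⟩
      countList R (xsOf path)          ≡⟨ countX-along hp R ⟩
      count n R                        ≤⟨ count≤1 n R (λ i j i≡x j≡x → trans (is-x i i≡x) (sym (is-x j j≡x))) ⟩
      1                                ∎)
      where
        open ≤-Reasoning
        R : Fin n → Bool
        R z = does (z FP.≟ x)
        N : Fin m → Bool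
        N y = (degY G y ≡ᵇ 1) ∧ adj G x y
        is-x : ∀ z → R z ≡ true → z ≡ x
        is-x z Rz with z FP.≟ x
        ... | yes z≡x = z≡x
        is-x z ()  | no _
        pendant-y : ∀ {y} → degY G y ≡ 1 → (degY G y ≡ᵇ 1) ≡ true
        pendant-y {y} deg = T⇒true (≡⇒≡ᵇ (degY G y) 1 deg)
        closed : ∀ z y → N y ≡ true → adj G z y ≡ true → R z ≡ true
        closed z y Ny z~y with z FP.≟ x
        ... | yes _   = refl
        ... | no  z≢x = ⊥-elim (true≢false (trans (sym (∧-trueˡ Ny))
                          (≥2⇒≢ᵇ1 (count≥2 n (λ w → adj G w y) z x z≢x z~y (∧-trueʳ Ny)))))
        open ClosedPair R N closed
        x′ : Fin n
        x′ = proj₁ (another 2≤n x)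
        x′≢x : x′ ≢ x
        x′≢x = proj₂ (another 2≤n x)

-- The theorem.
lemma6 : ∀ {n m : ℕ} (G : BipGraph n m) → Connected G → Convex G →
    HamiltonianPath G → PropertyB G
lemma6 G _ convex hp = upperBound G hp , lowerBound G convex hp , pendantBound G hp
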